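{- Let $p\ge1$, let $n_1,\dots,n_p\ge1$ and $k_s\in[n_s]$ for each $s\in[p]$. If there exists a non-trivially intersecting family in $\prod_s\binom{[n_s]}{k_s}$, then there is a non-trivially intersecting family $\mathcal{F}'\subseteq\prod_s\binom{[n_s]}{k_s}$ of maximum size (among all non-trivially intersecting subfamilies of $\prod_s\binom{[n_s]}{k_s}$) which is $Q$-shifted for some $Q\subseteq[p]$.
   Context: Multi-part setting: the ground set is the disjoint union $\bigsqcup_{s=1}^p[n_s]$; a subset is written $\bigsqcup_sF_s$ with $F_s\subseteq[n_s]$, and $\prod_s\binom{[n_s]}{k_s}$ is the family of all subsets with exactly $k_s$ elements in each part $s$. A family is intersecting if any two members share an element of the ground set; trivially intersecting if some element of the ground set lies in every member; non-trivially intersecting if intersecting but not trivially intersecting. Shifting: for $t\in[p]$, $1\le i<j\le n_t$ and $F=\bigsqcup_sF_s$, $S^{i,j}_t(F)=F$ if $i\in F_t$ or $j\notin F_t$; otherwise $S^{i,j}_t(F)$ replaces $F_t$ by $(F_t\setminus\{j\})\cup\{i\}$. For a family, $S^{i,j}_t(\mathcal{F})=\{S^{i,j}_t(F):F\in\mathcal{F}\}\cup\{F:F\in\mathcal{F},\ S^{i,j}_t(F)\in\mathcal{F}\}$. $\mathcal{F}$ is $t$-shifted if $S^{i,j}_t(\mathcal{F})=\mathcal{F}$ for all $1\le i<j\le n_t$. A non-trivially intersecting family $\mathcal{F}\subseteq\prod_s\binom{[n_s]}{k_s}$ is $Q$-shifted (for $Q\subseteq[p]$) if it is $s$-shifted for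 every $s\in Q$, and for every $s\notin Q$ there exist $1\le i_s<j_s\le n_s$ such that $S^{i_s,j_s}_s(\mathcal{F})$ is trivially intersecting. -}

module Defs where

open import Data.Nat using (ℕ; zero; suc; _≤_)
open import Data.Fin using (Fin; zero; suc; _<_)
open import Data.Vec using (Vec; []; _∷_; lookup; _[_]≔_)
open import Data.Bool using (Bool; true; false; if_then_else_; _∨_; not)
open import Data.Fin.Subset as Sub using (Subset; ∣_∣; inside; outside)
open import Data.List using (List; length)
open import Data.List.Membership.Propositional using () renaming (_∈_ to _∈ₗ_)
open import Data.List.Relation.Unary.Unique.Propositional using (Unique)
open import Data.Product using (Σ; ∃; ∃-syntax; _×_; _,_)
open import Data.Sum using (_⊎_)
open import Relation.Nullary using (¬_)
open import Relation.Binary.PropositionalEquality using (_≡_)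
open import Function.Bundles using (_⇔_)

-- A subset of the disjoint union ⊔_s [n_s] (parts indexed by s : Fin p),
-- given as one Subset (n_s) per part.
data MSet : ∀ {p} → Vec ℕ p → Set where
  []  : MSet []
  _∷_ : ∀ {p n} {ns : Vec ℕ p} → Subset n → MSet ns → MSet (n ∷ ns)

part : ∀ {p} {ns : Vec ℕ p} → MSet ns → (s : Fin p) → Subset (lookup ns s)
part (A ∷ F) zero    = A
part (A ∷ F) (suc s) = part F s

setPart : ∀ {p} {ns : Vec ℕ p} → MSet ns → (s : Fin p) → Subset (lookup ns s) → MSet ns
setPart (A ∷ F) zero    B = B ∷ F
setPart (A ∷ F) (suc s) B = A ∷ setPart F s B

InProduct : ∀ {p} {ns : Vec ℕ p} → Vec ℕ p → MSet ns → Set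
InProduct ks F = ∀ s → ∣ part F s ∣ ≡ lookup ks s

-- Families are treated as predicates on MSet ns (membership); concrete
-- finite families are duplicate-free lists.

module _ {p : ℕ} {ns : Vec ℕ p} where

  _∈ₘ_ : (Σ (Fin p) λ s → Fin (lookup ns s)) → MSet ns → Set
  (s , x) ∈ₘ F = x Sub.∈ part F s

  Intersecting : (MSet ns → Set) → Set
  Intersecting 𝓕 = ∀ A B → 𝓕 A → 𝓕 B → ∃[ e ] (e ∈ₘ A × e ∈ₘ B)

  TriviallyIntersecting : (MSet ns → Set) → Set
  TriviallyIntersecting 𝓕 = ∃[ e ] (∀ A → 𝓕 A → e ∈ₘ A)

  NonTriviallyIntersecting : (MSet ns → Set) → Set
  NonTriviallyIntersecting 𝓕 = Intersecting 𝓕 × ¬ TriviallyIntersecting 𝓕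

  shiftSet : (t : Fin p) (i j : Fin (lookup ns t)) → MSet ns → MSet ns
  shiftSet t i j F =
    if lookup (part F t) i ∨ not (lookup (part F t) j)
    then F
    else setPart F t ((part F t [ j ]≔ outside) [ i ]≔ inside)

  shiftFam : (t : Fin p) (i j : Fin (lookup ns t)) → (MSet ns → Set) → (MSet ns → Set)
  shiftFam t i j 𝓕 G = (∃[ F ] (𝓕 F × G ≡ shiftSet t i j F)) ⊎ (𝓕 G × 𝓕 (shiftSet t i j G))

  Shifted : (t : Fin p) → (MSet ns → Set) → Set
  Shifted t 𝓕 = ∀ (i j : Fin (lookup ns t)) → i < j → ∀ G → (shiftFam t i j 𝓕 G ⇔ 𝓕 G)

  QShifted : Subset p → (MSet ns → Set) → Set
  QShifted Q 𝓕 = NonTriviallyIntersecting 𝓕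
    × (∀ s → s Sub.∈ Q → Shifted s 𝓕)
    × (∀ s → ¬ (s Sub.∈ Q) →
         ∃[ i ] ∃[ j ] (i < j × TriviallyIntersecting (shiftFam s i j 𝓕)))

  FamilyIn : Vec ℕ p → List (MSet ns) → Set
  FamilyIn ks 𝓕 = Unique 𝓕 × (∀ F → F ∈ₗ 𝓕 → InProduct ks F)

  ⟦_⟧ : List (MSet ns) → MSet ns → Set
  ⟦ 𝓕 ⟧ F = F ∈ₗ 𝓕

-- Among the non-trivially intersecting families of maximum size (one exists, everything
-- being finite) start from any one.  As long as some shift S^{i,j}_t with i < j moves the
-- family and leaves it non-trivially intersecting, replace the family by its shift: this
-- keeps the size, the product condition and the intersection property, and strictly
-- decreases the total sum of the indices of the elements, so the process stops.  Let Q be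
-- the set of parts t for which every S^{i,j}_t fixes the final family: for t ∉ Q some
-- shift moves the family, and that shift must make it trivially intersecting.

module Submission where

open import Defs
open import Data.Nat using (ℕ; zero; suc; _+_; _≤_; _<_; _≥_; z≤n; s≤s)
open import Data.Nat.Induction using (<-wellFounded)
open import Induction.WellFounded using (Acc; acc)
import Data.Nat.Properties as ℕ
open import Data.Fin as Fin using (Fin; zero; suc)
import Data.Fin.Properties as Fin
open import Data.Vec using (Vec; []; _∷_; lookup; _[_]≔_; tabulate)
import Data.Vec.Properties as Vec
open import Data.Bool using (true; false)
import Data.Bool.Properties as Bool
open import Data.Fin.Subset as Subset using (Subset; ∣_∣; inside; outside)
import Data.Fin.Subset.Properties as SubsetP
open import Data.Product using (Σ; ∃; ∃-syntax; _×_; _,_; proj₁; proj₂; map₂; swap; assocʳ′; assocˡ′)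
open import Data.Sum using (_⊎_; inj₁; inj₂)
open import Relation.Nullary using (¬_; Dec; yes; no; does; contradiction)
import Relation.Nullary.Decidable as Dec
open import Relation.Nullary.Decidable using (_×-dec_; ¬?; dec-true; decidable-stable)
open import Relation.Unary using (Decidable)
open import Relation.Binary.Definitions using (DecidableEquality)
open import Relation.Binary.PropositionalEquality hiding ([_])
open import Level using (Level; _⊔_)
open import Function using (_∘_; _⇔_; mk⇔; Equivalence)
open import Data.List using (List; []; _∷_; [_]; _++_; map; length; filter; deduplicate; cartesianProductWith)
open import Data.List.Relation.Binary.Subset.Propositional using (_⊆_)
open import Data.List.Extrema.Nat using (argmax; argmax-all; f[xs]≤f[argmax])
open import Data.Nat.ListAction using (sum)
import Data.List.Properties as List
open import Data.List.Membership.Propositional using (_∈_; _∉_; find; lose)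
open import Data.List.Membership.Propositional.Properties
  using (∈-map⁺; ∈-map⁻; ∈-++⁺ˡ; ∈-++⁺ʳ; ∈-filter⁺; ∈-filter⁻; ∈-deduplicate⁺; ∈-cartesianProductWith⁺)
open import Data.List.Relation.Unary.Any as Any using (Any; here; there)
open import Data.List.Relation.Unary.All as All using (All; []; _∷_)
import Data.List.Relation.Unary.All.Properties as All
open import Data.List.Relation.Unary.AllPairs using ([]; _∷_)
open import Data.List.Relation.Unary.Unique.Propositional using (Unique)

private variable
  a b : Level
  X Y : Set a
  n p : ℕ
  ns : Vec ℕ p

Unique-map⁺ : (f : X → Y) {xs : List X} → (∀ {x y} → x ∈ xs → y ∈ xs → f x ≡ f y → x ≡ y)
  → Unique xs → Unique (map f xs)
Unique-map⁺ f {[]}     _   []           = []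
Unique-map⁺ f {x ∷ xs} inj (x∉xs ∷ xs!) =
  All.map⁺ (All.tabulate λ y∈xs fx≡fy → All.lookup x∉xs y∈xs (inj (here refl) (there y∈xs) fx≡fy))
  ∷ Unique-map⁺ f (λ x∈ y∈ → inj (there x∈) (there y∈)) xs!

sum-map-≤ : (f g : X → ℕ) (xs : List X) → (∀ {x} → x ∈ xs → f x ≤ g x) → sum (map f xs) ≤ sum (map g xs)
sum-map-≤ f g []       _   = z≤n
sum-map-≤ f g (x ∷ xs) f≤g = ℕ.+-mono-≤ (f≤g (here refl)) (sum-map-≤ f g xs (f≤g ∘ there))

sum-map-< : (f g : X → ℕ) (xs : List X) → (∀ {x} → x ∈ xs → f x ≤ g x) → Any (λ x → f x < g x) xs
  → sum (map f xs) < sum (map g xs)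
sum-map-< f g (x ∷ xs) f≤g (here fx<gx) = ℕ.+-mono-<-≤ fx<gx (sum-map-≤ f g xs (f≤g ∘ there))
sum-map-< f g (x ∷ xs) f≤g (there f<g)  = ℕ.+-mono-≤-< (f≤g (here refl)) (sum-map-< f g xs (f≤g ∘ there) f<g)

∈-─ : {x y : X} {xs : List X} (x∈xs : x ∈ xs) → y ∈ xs → y ≢ x → y ∈ (xs Any.─ x∈xs)
∈-─ (here refl) (here refl) y≢x = contradiction refl y≢x
∈-─ (here refl) (there y∈) _    = y∈
∈-─ (there x∈) (here refl) _    = here refl
∈-─ (there x∈) (there y∈) y≢x   = there (∈-─ x∈ y∈ y≢x)

Unique⇒length-≤ : {xs ys : List X} → Unique xs → xs ⊆ ys → length xs ≤ length ys
Unique⇒length-≤ {xs = []}              _            _     = z≤n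
Unique⇒length-≤ {xs = x ∷ xs} {ys} (x∉xs ∷ xs!) xs⊆ys = begin
  suc (length xs)            ≤⟨ s≤s (Unique⇒length-≤ xs! xs⊆ys─x) ⟩
  suc (length (ys Any.─ x∈ys)) ≡⟨ List.length-removeAt′ ys (Any.index x∈ys) ⟨
  length ys                  ∎
  where
  open ℕ.≤-Reasoning
  x∈ys = xs⊆ys (here refl)
  xs⊆ys─x : xs ⊆ (ys Any.─ x∈ys)
  xs⊆ys─x y∈xs = ∈-─ x∈ys (xs⊆ys (there y∈xs)) (All.lookup x∉xs y∈xs ∘ sym)

sublists : List X → List (List X)
sublists []       = [ [] ]
sublists (x ∷ xs) = map (x ∷_) (sublists xs) ++ sublists xs

filter∈sublists : ∀ {P : X → Set b} (P? : Decidable P) xs → filter P? xs ∈ sublists xs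
filter∈sublists P? []       = here refl
filter∈sublists P? (x ∷ xs) with does (P? x)
... | true  = ∈-++⁺ˡ (∈-map⁺ (x ∷_) (filter∈sublists P? xs))
... | false = ∈-++⁺ʳ (map (x ∷_) (sublists xs)) (filter∈sublists P? xs)

∀∈? : ∀ {P : X → Set b} → Decidable P → (xs : List X) → Dec (∀ x → x ∈ xs → P x)
∀∈? P? xs = Dec.map′ (λ all x → All.lookup all) (λ h → All.tabulate (h _)) (All.all? P? xs)

module Largest {X : Set a} (_≟_ : DecidableEquality X) (universe : List X) (complete : ∀ x → x ∈ universe)
  {P : List X → Set b} (P? : Decidable P) (P-resp : ∀ {xs ys} → xs ⊆ ys → ys ⊆ xs → P xs → P ys) where

  open import Data.List.Membership.DecPropositional _≟_ using (_∈?_)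
  open import Data.List.Relation.Unary.Unique.DecPropositional _≟_ using (unique?)
  open import Data.List.Relation.Unary.Unique.DecPropositional.Properties _≟_ using (deduplicate-!)
  import Data.List.Relation.Unary.Unique.Propositional.Properties as Unique

  Admissible : List X → Set (a ⊔ b)
  Admissible xs = Unique xs × P xs

  normalise : List X → List X
  normalise xs = filter (_∈? xs) (deduplicate _≟_ universe)

  normalise-admissible : ∀ {xs} → Admissible xs → Admissible (normalise xs)
  normalise-admissible {xs} (_ , Pxs) = Unique.filter⁺ (_∈? xs) (deduplicate-! universe) , P-resp ⊆norm norm⊆ Pxs
    where
    ⊆norm : xs ⊆ normalise xs
    ⊆norm x∈xs = ∈-filter⁺ (_∈? xs) (∈-deduplicate⁺ _≟_ (complete _)) x∈xs
    norm⊆ : normalise xs ⊆ xs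
    norm⊆ x∈ = proj₂ (∈-filter⁻ (_∈? xs) {xs = deduplicate _≟_ universe} x∈)

  admissible? : Decidable Admissible
  admissible? xs = unique? xs ×-dec P? xs

  candidates : List (List X)
  candidates = filter admissible? (sublists (deduplicate _≟_ universe))

  normalise∈candidates : ∀ {xs} → Admissible xs → normalise xs ∈ candidates
  normalise∈candidates {xs} adm = ∈-filter⁺ admissible?
    (filter∈sublists (_∈? xs) (deduplicate _≟_ universe)) (normalise-admissible adm)

  length-≤-normalise : ∀ {xs} → Unique xs → length xs ≤ length (normalise xs)
  length-≤-normalise {xs} xs! =
    Unique⇒length-≤ xs! λ x∈xs → ∈-filter⁺ (_∈? xs) (∈-deduplicate⁺ _≟_ (complete _)) x∈xs

  largest : ∃ Admissible → ∃[ ys ] (Admissible ys × ∀ xs → Admissible xs → length xs ≤ length ys)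
  largest (xs₀ , adm₀) = ys , ys-admissible , ys-largest
    where
    ys = argmax length (normalise xs₀) candidates
    ys-admissible : Admissible ys
    ys-admissible = argmax-all length {P = Admissible} (normalise-admissible adm₀)
      (All.all-filter admissible? (sublists (deduplicate _≟_ universe)))
    ys-largest : ∀ xs → Admissible xs → length xs ≤ length ys
    ys-largest xs adm = ℕ.≤-trans (length-≤-normalise (proj₁ adm))
      (All.lookup (f[xs]≤f[argmax] {f = length} (normalise xs₀) candidates) (normalise∈candidates adm))

-- Subsets of [n]

comprehension : {P : Fin p → Set b} → Decidable P → Subset p
comprehension P? = tabulate (does ∘ P?)

∈-comprehension⁻ : {P : Fin p → Set b} (P? : Decidable P) {s : Fin p} → s Subset.∈ comprehension P? → P s
∈-comprehension⁻ P? {s} s∈ with P? s | trans (sym (Vec.lookup∘tabulate (does ∘ P?) s)) (Vec.[]=⇒lookup s∈)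
... | yes Ps | _ = Ps
... | no  _  | ()

∉-comprehension⁻ : {P : Fin p → Set b} (P? : Decidable P) {s : Fin p} → ¬ s Subset.∈ comprehension P? → ¬ P s
∉-comprehension⁻ P? {s} s∉ Ps =
  s∉ (Vec.lookup⇒[]= s _ (trans (Vec.lookup∘tabulate (does ∘ P?) s) (dec-true (P? s) Ps)))

move : Subset n → Fin n → Fin n → Subset n
move v i j = (v [ j ]≔ outside) [ i ]≔ inside

∣insert∣ : (v : Subset n) (i : Fin n) → lookup v i ≡ false → ∣ v [ i ]≔ inside ∣ ≡ suc ∣ v ∣
∣insert∣ (false ∷ v) zero    _ = refl
∣insert∣ (true  ∷ v) (suc i) e = cong suc (∣insert∣ v i e)
∣insert∣ (false ∷ v) (suc i) e = ∣insert∣ v i e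

∣remove∣ : (v : Subset n) (j : Fin n) → lookup v j ≡ true → suc ∣ v [ j ]≔ outside ∣ ≡ ∣ v ∣
∣remove∣ (true  ∷ v) zero    _ = refl
∣remove∣ (true  ∷ v) (suc j) e = cong suc (∣remove∣ v j e)
∣remove∣ (false ∷ v) (suc j) e = ∣remove∣ v j e

∣remove∣≤ : (v : Subset n) (j : Fin n) → ∣ v [ j ]≔ outside ∣ ≤ ∣ v ∣
∣remove∣≤ (true  ∷ v) zero    = ℕ.n≤1+n _
∣remove∣≤ (false ∷ v) zero    = ℕ.≤-refl
∣remove∣≤ (true  ∷ v) (suc j) = s≤s (∣remove∣≤ v j)
∣remove∣≤ (false ∷ v) (suc j) = ∣remove∣≤ v j

∣move∣ : (v : Subset n) {i j : Fin n} → i ≢ j → lookup v i ≡ false → lookup v j ≡ true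
  → ∣ move v i j ∣ ≡ ∣ v ∣
∣move∣ v {i} {j} i≢j i∉v j∈v = begin
  ∣ move v i j ∣                   ≡⟨ ∣insert∣ (v [ j ]≔ outside) i (trans (Vec.lookup∘update′ i≢j v outside) i∉v) ⟩
  suc ∣ v [ j ]≔ outside ∣         ≡⟨ ∣remove∣ v j j∈v ⟩
  ∣ v ∣                            ∎
  where open ≡-Reasoning

-- the sum of the indices of the members of v
indexSum : Subset n → ℕ
indexSum []      = 0
indexSum (_ ∷ v) = ∣ v ∣ + indexSum v

indexSum-remove-≤ : (v : Subset n) (j : Fin n) → indexSum (v [ j ]≔ outside) ≤ indexSum v
indexSum-remove-≤ (_ ∷ v) zero    = ℕ.≤-refl
indexSum-remove-≤ (_ ∷ v) (suc j) = ℕ.+-mono-≤ (∣remove∣≤ v j) (indexSum-remove-≤ v j)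

indexSum-move-< : (v : Subset n) {i j : Fin n} → i Fin.< j → lookup v i ≡ false → lookup v j ≡ true
  → indexSum (move v i j) < indexSum v
indexSum-move-< (false ∷ v) {zero} {suc j} _ _ j∈v =
  ℕ.+-mono-<-≤ (ℕ.≤-reflexive (∣remove∣ v j j∈v)) (indexSum-remove-≤ v j)
indexSum-move-< (_ ∷ v) {suc i} {suc j} (s≤s i<j) i∉v j∈v =
  subst (λ k → k + indexSum (move v i j) < ∣ v ∣ + indexSum v)
    (sym (∣move∣ v (Fin.<⇒≢ i<j) i∉v j∈v))
    (ℕ.+-monoʳ-< ∣ v ∣ (indexSum-move-< v i<j i∉v j∈v))

move-move : (v : Subset n) {i j : Fin n} → i ≢ j → lookup v i ≡ false → lookup v j ≡ true
  → move (move v i j) j i ≡ v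
move-move v {i} {j} i≢j i∉v j∈v = begin
  (((v [ j ]≔ outside) [ i ]≔ inside) [ i ]≔ outside) [ j ]≔ inside
    ≡⟨ cong (_[ j ]≔ inside) (Vec.[]≔-idempotent (v [ j ]≔ outside) i) ⟩
  ((v [ j ]≔ outside) [ i ]≔ outside) [ j ]≔ inside
    ≡⟨ cong (_[ j ]≔ inside) (Vec.[]≔-commutes v j i (i≢j ∘ sym)) ⟩
  ((v [ i ]≔ outside) [ j ]≔ outside) [ j ]≔ inside
    ≡⟨ Vec.[]≔-idempotent (v [ i ]≔ outside) j ⟩
  (v [ i ]≔ outside) [ j ]≔ inside
    ≡⟨ cong₂ (λ a b → (v [ i ]≔ a) [ j ]≔ b) (sym i∉v) (sym j∈v) ⟩
  (v [ i ]≔ lookup v i) [ j ]≔ lookup v j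
    ≡⟨ cong (_[ j ]≔ lookup v j) (Vec.[]≔-lookup v i) ⟩
  v [ j ]≔ lookup v j
    ≡⟨ Vec.[]≔-lookup v j ⟩
  v ∎
  where open ≡-Reasoning

lookup-move-j : (v : Subset n) {i j : Fin n} → i ≢ j → lookup (move v i j) j ≡ false
lookup-move-j v {i} {j} i≢j = begin
  lookup (move v i j) j              ≡⟨ Vec.lookup∘update′ (i≢j ∘ sym) (v [ j ]≔ outside) inside ⟩
  lookup (v [ j ]≔ outside) j        ≡⟨ Vec.lookup∘update j v outside ⟩
  false                              ∎
  where open ≡-Reasoning

lookup-move-other : (v : Subset n) {i j x : Fin n} → x ≢ i → x ≢ j → lookup (move v i j) x ≡ lookup v x
lookup-move-other v {i} {j} x≢i x≢j =
  trans (Vec.lookup∘update′ x≢i (v [ j ]≔ outside) inside) (Vec.lookup∘update′ x≢j v outside)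

∈-move⁺ : (v : Subset n) {i j x : Fin n} → x Subset.∈ v → x ≢ j → x Subset.∈ move v i j
∈-move⁺ v {i} {j} {x} x∈v x≢j with x Fin.≟ i
... | yes refl = Vec.[]≔-updates (v [ j ]≔ outside) x
... | no x≢i   = Vec.[]≔-minimal (v [ j ]≔ outside) x i x≢i (Vec.[]≔-minimal v x j x≢j x∈v)

∈-move⁻ : (v : Subset n) {i j x : Fin n} → i ≢ j → x Subset.∈ move v i j → x ≢ i → x Subset.∈ v
∈-move⁻ v {i} {j} {x} i≢j x∈move x≢i with x Fin.≟ j
... | yes refl = contradiction (trans (sym (Vec.[]=⇒lookup x∈move)) (lookup-move-j v i≢j)) λ ()
... | no x≢j   = Vec.lookup⇒[]= x v (trans (sym (lookup-move-other v x≢i x≢j)) (Vec.[]=⇒lookup x∈move))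

allSubsets : (n : ℕ) → List (Subset n)
allSubsets zero    = [ [] ]
allSubsets (suc n) = map (inside ∷_) (allSubsets n) ++ map (outside ∷_) (allSubsets n)

∈-allSubsets : (v : Subset n) → v ∈ allSubsets n
∈-allSubsets []                = here refl
∈-allSubsets {suc n} (true ∷ v)  = ∈-++⁺ˡ (∈-map⁺ (inside ∷_) (∈-allSubsets v))
∈-allSubsets {suc n} (false ∷ v) = ∈-++⁺ʳ (map (inside ∷_) (allSubsets n)) (∈-map⁺ (outside ∷_) (∈-allSubsets v))

-- Sets in the disjoint union

part-setPart : (F : MSet ns) (t : Fin p) (B : Subset (lookup ns t)) → part (setPart F t B) t ≡ B
part-setPart (A ∷ F) zero    B = refl
part-setPart (A ∷ F) (suc t) B = part-setPart F t B

part-setPart-≢ : (F : MSet ns) {s t : Fin p} (B : Subset (lookup ns t)) → s ≢ t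
  → part (setPart F t B) s ≡ part F s
part-setPart-≢ (A ∷ F) {zero}  {zero}  B s≢t = contradiction refl s≢t
part-setPart-≢ (A ∷ F) {zero}  {suc t} B s≢t = refl
part-setPart-≢ (A ∷ F) {suc s} {zero}  B s≢t = refl
part-setPart-≢ (A ∷ F) {suc s} {suc t} B s≢t = part-setPart-≢ F B (s≢t ∘ cong suc)

setPart-setPart : (F : MSet ns) (t : Fin p) (B C : Subset (lookup ns t))
  → setPart (setPart F t B) t C ≡ setPart F t C
setPart-setPart (A ∷ F) zero    B C = refl
setPart-setPart (A ∷ F) (suc t) B C = cong (A ∷_) (setPart-setPart F t B C)

setPart-part : (F : MSet ns) (t : Fin p) → setPart F t (part F t) ≡ F
setPart-part (A ∷ F) zero    = refl
setPart-part (A ∷ F) (suc t) = cong (A ∷_) (setPart-part F t)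

weight : MSet ns → ℕ
weight []      = 0
weight (A ∷ F) = indexSum A + weight F

totalWeight : List (MSet ns) → ℕ
totalWeight L = sum (map weight L)

weight-setPart-< : (F : MSet ns) (t : Fin p) (B : Subset (lookup ns t)) → indexSum B < indexSum (part F t)
  → weight (setPart F t B) < weight F
weight-setPart-< (A ∷ F) zero    B lt = ℕ.+-monoˡ-< (weight F) lt
weight-setPart-< (A ∷ F) (suc t) B lt = ℕ.+-monoʳ-< (indexSum A) (weight-setPart-< F t B lt)

_≟ₘ_ : DecidableEquality (MSet ns)
[]      ≟ₘ []      = yes refl
(A ∷ F) ≟ₘ (B ∷ G) with Vec.≡-dec Bool._≟_ A B | F ≟ₘ G
... | yes refl | yes refl = yes refl
... | no A≢B   | _        = no λ { refl → A≢B refl }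
... | yes _    | no F≢G   = no λ { refl → F≢G refl }

Meets : MSet ns → MSet ns → Set
Meets A B = ∃[ e ] (e ∈ₘ A × e ∈ₘ B)

allMSets : (ns : Vec ℕ p) → List (MSet ns)
allMSets []       = [ [] ]
allMSets (n ∷ ns) = cartesianProductWith _∷_ (allSubsets n) (allMSets ns)

∈-allMSets : (F : MSet ns) → F ∈ allMSets ns
∈-allMSets []      = here refl
∈-allMSets (A ∷ F) = ∈-cartesianProductWith⁺ _∷_ (∈-allSubsets A) (∈-allMSets F)

module _ {p} {ns : Vec ℕ p} where

  Element : Set
  Element = Σ (Fin p) λ s → Fin (lookup ns s)

  anyElement? : {Q : Element → Set b} → Decidable Q → Dec (∃ Q)
  anyElement? Q? = Dec.map′ (λ (s , x , q) → (s , x) , q) (λ ((s , x) , q) → s , x , q)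
    (Fin.any? λ s → Fin.any? λ x → Q? (s , x))

  _∈ₘ?_ : (e : Element) (A : MSet ns) → Dec (e ∈ₘ A)
  (s , x) ∈ₘ? A = x SubsetP.∈? part A s

  meets? : (A B : MSet ns) → Dec (Meets A B)
  meets? A B = anyElement? λ e → e ∈ₘ? A ×-dec e ∈ₘ? B

  intersecting? : (L : List (MSet ns)) → Dec (Intersecting ⟦ L ⟧)
  intersecting? L = Dec.map′ (λ h A B A∈ B∈ → h A A∈ B B∈) (λ I A A∈ B B∈ → I A B A∈ B∈)
    (∀∈? (λ A → ∀∈? (meets? A) L) L)

  triviallyIntersecting? : (L : List (MSet ns)) → Dec (TriviallyIntersecting ⟦ L ⟧)
  triviallyIntersecting? L = anyElement? λ e → ∀∈? (e ∈ₘ?_) L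

  nonTriviallyIntersecting? : (L : List (MSet ns)) → Dec (NonTriviallyIntersecting ⟦ L ⟧)
  nonTriviallyIntersecting? L = intersecting? L ×-dec ¬? (triviallyIntersecting? L)

  inProduct? : (ks : Vec ℕ p) (A : MSet ns) → Dec (InProduct ks A)
  inProduct? ks A = Fin.all? λ s → ∣ part A s ∣ ℕ.≟ lookup ks s

  Intersecting-mono : {𝓕 𝓖 : MSet ns → Set} → (∀ {G} → 𝓖 G → 𝓕 G) → Intersecting 𝓕 → Intersecting 𝓖
  Intersecting-mono 𝓖⊆𝓕 I A B a b = I A B (𝓖⊆𝓕 a) (𝓖⊆𝓕 b)

  TriviallyIntersecting-mono : {𝓕 𝓖 : MSet ns → Set} → (∀ {G} → 𝓖 G → 𝓕 G)
    → TriviallyIntersecting 𝓕 → TriviallyIntersecting 𝓖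
  TriviallyIntersecting-mono 𝓖⊆𝓕 (e , e∈) = e , λ A a → e∈ A (𝓖⊆𝓕 a)

  NonTriviallyIntersecting-resp : {𝓕 𝓖 : MSet ns → Set} → (∀ {G} → 𝓖 G → 𝓕 G) → (∀ {G} → 𝓕 G → 𝓖 G)
    → NonTriviallyIntersecting 𝓕 → NonTriviallyIntersecting 𝓖
  NonTriviallyIntersecting-resp 𝓖⊆𝓕 𝓕⊆𝓖 (I , ¬T) = Intersecting-mono 𝓖⊆𝓕 I , ¬T ∘ TriviallyIntersecting-mono 𝓕⊆𝓖

-- Shifting

module _ {p} {ns : Vec ℕ p} (t : Fin p) (i j : Fin (lookup ns t)) (L : List (MSet ns)) where
  open import Data.List.Membership.DecPropositional (_≟ₘ_ {ns = ns}) using (_∈?_)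

  shiftIn : MSet ns → MSet ns
  shiftIn A with shiftSet t i j A ∈? L
  ... | yes _ = A
  ... | no  _ = shiftSet t i j A

  shiftIn-cases : ∀ A → (shiftSet t i j A ∈ L × shiftIn A ≡ A)
                      ⊎ (shiftSet t i j A ∉ L × shiftIn A ≡ shiftSet t i j A)
  shiftIn-cases A with shiftSet t i j A ∈? L
  ... | yes SA∈L = inj₁ (SA∈L , refl)
  ... | no  SA∉L = inj₂ (SA∉L , refl)

  shiftList : List (MSet ns)
  shiftList = map shiftIn L

  Closed : Set
  Closed = All (λ A → shiftSet t i j A ∈ L) L

  closed? : Dec Closed
  closed? = All.all? (λ A → shiftSet t i j A ∈? L) L

  ¬closed⇒escaping : ¬ Closed → ∃[ A ] (A ∈ L × shiftSet t i j A ∉ L)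
  ¬closed⇒escaping = find ∘ All.¬All⇒Any¬ (λ A → shiftSet t i j A ∈? L) L

module Shift {p} {ns : Vec ℕ p} (t : Fin p) (i j : Fin (lookup ns t)) (i≢j : i ≢ j) where

  shiftPart : MSet ns → MSet ns
  shiftPart A = setPart A t (move (part A t) i j)

  Movable : MSet ns → Set
  Movable A = lookup (part A t) i ≡ false × lookup (part A t) j ≡ true

  shiftSet-cases : ∀ A → (Movable A × shiftSet t i j A ≡ shiftPart A) ⊎ (¬ Movable A × shiftSet t i j A ≡ A)
  shiftSet-cases A with lookup (part A t) i | lookup (part A t) j
  ... | true  | _     = inj₂ ((λ { (() , _) }) , refl)
  ... | false | false = inj₂ ((λ { (_ , ()) }) , refl)
  ... | false | true  = inj₁ ((refl , refl) , refl)

  part-shiftPart : ∀ A → part (shiftPart A) t ≡ move (part A t) i j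
  part-shiftPart A = part-setPart A t (move (part A t) i j)

  i∈shiftPart : ∀ A → (t , i) ∈ₘ shiftPart A
  i∈shiftPart A = subst (i Subset.∈_) (sym (part-shiftPart A)) (Vec.[]≔-updates (part A t [ j ]≔ outside) i)

  j∉shiftPart : ∀ A → ¬ (t , j) ∈ₘ shiftPart A
  j∉shiftPart A j∈ = contradiction
    (trans (sym (Vec.[]=⇒lookup (subst (j Subset.∈_) (part-shiftPart A) j∈))) (lookup-move-j (part A t) i≢j))
    λ ()

  ∈-shiftPart⁺ : ∀ A e → e ∈ₘ A → e ∈ₘ shiftPart A ⊎ e ≡ (t , j)
  ∈-shiftPart⁺ A (s , x) x∈A with s Fin.≟ t
  ... | no s≢t = inj₁ (subst (x Subset.∈_) (sym (part-setPart-≢ A _ s≢t)) x∈A)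
  ... | yes refl with x Fin.≟ j
  ...   | yes refl = inj₂ refl
  ...   | no x≢j   = inj₁ (subst (x Subset.∈_) (sym (part-shiftPart A)) (∈-move⁺ (part A t) x∈A x≢j))

  ∈-shiftPart⁻ : ∀ A e → e ∈ₘ shiftPart A → e ∈ₘ A ⊎ e ≡ (t , i)
  ∈-shiftPart⁻ A (s , x) x∈SA with s Fin.≟ t
  ... | no s≢t = inj₁ (subst (x Subset.∈_) (part-setPart-≢ A _ s≢t) x∈SA)
  ... | yes refl with x Fin.≟ i
  ...   | yes refl = inj₂ refl
  ...   | no x≢i   = inj₁ (∈-move⁻ (part A t) i≢j (subst (x Subset.∈_) (part-shiftPart A) x∈SA) x≢i)

  immovable-∋j⇒∋i : ∀ B → ¬ Movable B → (t , j) ∈ₘ B → (t , i) ∈ₘ B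
  immovable-∋j⇒∋i B B-immovable j∈B with lookup (part B t) i in i∈B
  ... | true  = Vec.lookup⇒[]= i (part B t) i∈B
  ... | false = contradiction (refl , Vec.[]=⇒lookup j∈B) B-immovable

  meets-shiftPart : ∀ F B → Movable F → Meets F (shiftPart B) → Meets (shiftPart F) B
  meets-shiftPart F B (i∉F , _) (e , e∈F , e∈SB) with ∈-shiftPart⁺ F e e∈F | ∈-shiftPart⁻ B e e∈SB
  ... | inj₁ e∈SF | inj₁ e∈B = e , e∈SF , e∈B
  ... | inj₂ refl | _        = contradiction e∈SB (j∉shiftPart B)
  ... | inj₁ _    | inj₂ refl = contradiction (trans (sym (Vec.[]=⇒lookup e∈F)) i∉F) λ ()

  Kept Moved : (MSet ns → Set) → MSet ns → Set
  Kept 𝓕 G  = 𝓕 G × 𝓕 (shiftSet t i j G)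
  Moved 𝓕 G = ∃[ F ] (𝓕 F × Movable F × G ≡ shiftPart F)

  shiftFam-cases : ∀ {𝓕 G} → shiftFam t i j 𝓕 G → Kept 𝓕 G ⊎ Moved 𝓕 G
  shiftFam-cases (inj₂ kept) = inj₁ kept
  shiftFam-cases {𝓕} (inj₁ (F , f , refl)) with shiftSet-cases F
  ... | inj₁ (F-movable , SF≡)   = inj₂ (F , f , F-movable , SF≡)
  ... | inj₂ (_ , SF≡F) rewrite SF≡F = inj₁ (f , subst 𝓕 (sym SF≡F) f)

  moved-meets-kept : ∀ {𝓕} → Intersecting 𝓕 → ∀ F B → 𝓕 F → Movable F → Kept 𝓕 B → Meets (shiftPart F) B
  moved-meets-kept {𝓕} I F B f F-movable (b , Sb) with I F B f b
  ... | e , e∈F , e∈B with ∈-shiftPart⁺ F e e∈F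
  ...   | inj₁ e∈SF = e , e∈SF , e∈B
  ...   | inj₂ refl with shiftSet-cases B
  ...     | inj₂ (B-immovable , _) = (t , i) , i∈shiftPart F , immovable-∋j⇒∋i B B-immovable e∈B
  ...     | inj₁ (_ , SB≡) = meets-shiftPart F B F-movable (I F (shiftPart B) f (subst 𝓕 SB≡ Sb))

  shiftFam-intersecting : ∀ {𝓕} → Intersecting 𝓕 → Intersecting (shiftFam t i j 𝓕)
  shiftFam-intersecting I A B a b with shiftFam-cases a | shiftFam-cases b
  ... | inj₁ (a′ , _) | inj₁ (b′ , _) = I A B a′ b′
  ... | inj₂ (F , f , F-movable , refl) | inj₁ kept = moved-meets-kept I F B f F-movable kept
  ... | inj₁ kept | inj₂ (F , f , F-movable , refl) = map₂ swap (moved-meets-kept I F A f F-movable kept)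
  ... | inj₂ (F , _ , _ , refl) | inj₂ (F′ , _ , _ , refl) = (t , i) , i∈shiftPart F , i∈shiftPart F′

  shiftPart-immovable : ∀ A → ¬ Movable (shiftPart A)
  shiftPart-immovable A (i∉SA , _) = contradiction (trans (sym (Vec.[]=⇒lookup (i∈shiftPart A))) i∉SA) λ ()

  shiftSet-idempotent : ∀ A → shiftSet t i j (shiftSet t i j A) ≡ shiftSet t i j A
  shiftSet-idempotent A with shiftSet-cases A
  ... | inj₂ (_ , SA≡A) = cong (shiftSet t i j) SA≡A
  ... | inj₁ (_ , SA≡) rewrite SA≡ with shiftSet-cases (shiftPart A)
  ...   | inj₁ (SA-movable , _) = contradiction SA-movable (shiftPart-immovable A)
  ...   | inj₂ (_ , SSA≡SA)     = SSA≡SA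

  unshiftPart : MSet ns → MSet ns
  unshiftPart A = setPart A t (move (part A t) j i)

  unshiftPart-shiftPart : ∀ A → Movable A → unshiftPart (shiftPart A) ≡ A
  unshiftPart-shiftPart A (i∉A , j∈A) = begin
    setPart (shiftPart A) t (move (part (shiftPart A) t) j i)
      ≡⟨ cong (λ v → setPart (shiftPart A) t (move v j i)) (part-shiftPart A) ⟩
    setPart (shiftPart A) t (move (move (part A t) i j) j i)
      ≡⟨ setPart-setPart A t _ _ ⟩
    setPart A t (move (move (part A t) i j) j i)
      ≡⟨ cong (setPart A t) (move-move (part A t) i≢j i∉A j∈A) ⟩
    setPart A t (part A t)
      ≡⟨ setPart-part A t ⟩
    A ∎
    where open ≡-Reasoning

  shiftPart-injective : ∀ A B → Movable A → Movable B → shiftPart A ≡ shiftPart B → A ≡ B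
  shiftPart-injective A B A-movable B-movable SA≡SB = begin
    A                           ≡⟨ unshiftPart-shiftPart A A-movable ⟨
    unshiftPart (shiftPart A)   ≡⟨ cong unshiftPart SA≡SB ⟩
    unshiftPart (shiftPart B)   ≡⟨ unshiftPart-shiftPart B B-movable ⟩
    B                           ∎
    where open ≡-Reasoning

  shiftPart-InProduct : ∀ {ks} A → Movable A → InProduct ks A → InProduct ks (shiftPart A)
  shiftPart-InProduct A (i∉A , j∈A) A∈ s with s Fin.≟ t
  ... | no s≢t   = trans (cong ∣_∣ (part-setPart-≢ A _ s≢t)) (A∈ s)
  ... | yes refl = trans (cong ∣_∣ (part-shiftPart A)) (trans (∣move∣ (part A t) i≢j i∉A j∈A) (A∈ t))

  shiftSet-InProduct : ∀ {ks} A → InProduct ks A → InProduct ks (shiftSet t i j A)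
  shiftSet-InProduct {ks} A A∈ with shiftSet-cases A
  ... | inj₁ (A-movable , SA≡) = subst (InProduct ks) (sym SA≡) (shiftPart-InProduct {ks} A A-movable A∈)
  ... | inj₂ (_ , SA≡A)        = subst (InProduct ks) (sym SA≡A) A∈

  weight-shiftPart-< : i Fin.< j → ∀ A → Movable A → weight (shiftPart A) < weight A
  weight-shiftPart-< i<j A (i∉A , j∈A) = weight-setPart-< A t _ (indexSum-move-< (part A t) i<j i∉A j∈A)

  module _ (L : List (MSet ns)) where

    ∈-shiftList⇔ : ∀ G → G ∈ shiftList t i j L ⇔ shiftFam t i j ⟦ L ⟧ G
    ∈-shiftList⇔ G = mk⇔ to from
      where
      to : G ∈ shiftList t i j L → shiftFam t i j ⟦ L ⟧ G
      to G∈ with ∈-map⁻ (shiftIn t i j L) G∈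
      ... | A , A∈L , refl with shiftIn-cases t i j L A
      ...   | inj₁ (SA∈L , SA≡A) rewrite SA≡A = inj₂ (A∈L , SA∈L)
      ...   | inj₂ (_ , SA≡)     rewrite SA≡  = inj₁ (A , A∈L , refl)

      from : shiftFam t i j ⟦ L ⟧ G → G ∈ shiftList t i j L
      from (inj₂ (G∈L , SG∈L)) with shiftIn-cases t i j L G
      ... | inj₁ (_ , SG≡G)   = subst (_∈ shiftList t i j L) SG≡G (∈-map⁺ (shiftIn t i j L) G∈L)
      ... | inj₂ (SG∉L , _)   = contradiction SG∈L SG∉L
      from (inj₁ (A , A∈L , refl)) with shiftIn-cases t i j L A
      ... | inj₂ (_ , SA≡)    = subst (_∈ shiftList t i j L) SA≡ (∈-map⁺ (shiftIn t i j L) A∈L)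
      ... | inj₁ (SA∈L , _) with shiftIn-cases t i j L (shiftSet t i j A)
      ...   | inj₁ (_ , SSA≡SA) = subst (_∈ shiftList t i j L) SSA≡SA (∈-map⁺ (shiftIn t i j L) SA∈L)
      ...   | inj₂ (SSA∉L , _)  = contradiction (subst (_∈ L) (sym (shiftSet-idempotent A)) SA∈L) SSA∉L

    shift∉⇒movable : ∀ {A} → A ∈ L → shiftSet t i j A ∉ L → Movable A × shiftSet t i j A ≡ shiftPart A
    shift∉⇒movable {A} A∈L SA∉L with shiftSet-cases A
    ... | inj₁ movable     = movable
    ... | inj₂ (_ , SA≡A) = contradiction (subst (_∈ L) (sym SA≡A) A∈L) SA∉L

    shiftIn-injectiveOn : ∀ {A B} → A ∈ L → B ∈ L → shiftIn t i j L A ≡ shiftIn t i j L B → A ≡ B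
    shiftIn-injectiveOn {A} {B} A∈L B∈L eq with shiftIn-cases t i j L A | shiftIn-cases t i j L B
    ... | inj₁ (_ , sA≡A) | inj₁ (_ , sB≡B) = trans (sym sA≡A) (trans eq sB≡B)
    ... | inj₁ (_ , sA≡A) | inj₂ (SB∉L , sB≡SB) =
      contradiction (subst (_∈ L) (trans (sym sA≡A) (trans eq sB≡SB)) A∈L) SB∉L
    ... | inj₂ (SA∉L , sA≡SA) | inj₁ (_ , sB≡B) =
      contradiction (subst (_∈ L) (trans (sym sB≡B) (trans (sym eq) sA≡SA)) B∈L) SA∉L
    ... | inj₂ (SA∉L , sA≡SA) | inj₂ (SB∉L , sB≡SB)
      with shift∉⇒movable A∈L SA∉L | shift∉⇒movable B∈L SB∉L
    ...   | A-movable , SA≡ | B-movable , SB≡ = shiftPart-injective A B A-movable B-movable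
      (trans (sym SA≡) (trans (sym sA≡SA) (trans eq (trans sB≡SB SB≡))))

    shiftList-Unique : Unique L → Unique (shiftList t i j L)
    shiftList-Unique = Unique-map⁺ (shiftIn t i j L) shiftIn-injectiveOn

    shiftList-InProduct : ∀ {ks} → (∀ A → A ∈ L → InProduct ks A) → ∀ G → G ∈ shiftList t i j L → InProduct ks G
    shiftList-InProduct {ks} L⊆ G G∈ with ∈-map⁻ (shiftIn t i j L) G∈
    ... | A , A∈L , refl with shiftIn-cases t i j L A
    ...   | inj₁ (_ , sA≡A)  = subst (InProduct ks) (sym sA≡A) (L⊆ A A∈L)
    ...   | inj₂ (_ , sA≡SA) = subst (InProduct ks) (sym sA≡SA) (shiftSet-InProduct {ks} A (L⊆ A A∈L))

    weight-shiftIn-≤ : i Fin.< j → ∀ A → weight (shiftIn t i j L A) ≤ weight A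
    weight-shiftIn-≤ i<j A with shiftIn-cases t i j L A
    ... | inj₁ (_ , sA≡A) = ℕ.≤-reflexive (cong weight sA≡A)
    ... | inj₂ (_ , sA≡SA) with shiftSet-cases A
    ...   | inj₁ (A-movable , SA≡) = subst (_≤ weight A) (cong weight (sym (trans sA≡SA SA≡)))
                                      (ℕ.<⇒≤ (weight-shiftPart-< i<j A A-movable))
    ...   | inj₂ (_ , SA≡A)       = ℕ.≤-reflexive (cong weight (trans sA≡SA SA≡A))

    weight-shiftIn-< : i Fin.< j → ∀ {A} → A ∈ L → shiftSet t i j A ∉ L → weight (shiftIn t i j L A) < weight A
    weight-shiftIn-< i<j {A} A∈L SA∉L with shiftIn-cases t i j L A | shift∉⇒movable A∈L SA∉L
    ... | inj₁ (SA∈L , _) | _                  = contradiction SA∈L SA∉L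
    ... | inj₂ (_ , sA≡SA) | A-movable , SA≡ = subst (_< weight A) (cong weight (sym (trans sA≡SA SA≡)))
                                                 (weight-shiftPart-< i<j A A-movable)

    totalWeight-shiftList-< : i Fin.< j → ¬ Closed t i j L → totalWeight (shiftList t i j L) < totalWeight L
    totalWeight-shiftList-< i<j ¬closed with ¬closed⇒escaping t i j L ¬closed
    ... | A , A∈L , SA∉L = subst (_< totalWeight L) (cong sum (List.map-∘ L))
      (sum-map-< (weight ∘ shiftIn t i j L) weight L (λ {A} _ → weight-shiftIn-≤ i<j A)
        (lose A∈L (weight-shiftIn-< i<j A∈L SA∉L)))

-- Shifting until stable

module _ {p} {ns : Vec ℕ p} where

  Unclosed : Fin p → List (MSet ns) → Set
  Unclosed t L = ∃[ i ] ∃[ j ] (i Fin.< j × ¬ Closed t i j L)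

  unclosed? : ∀ t L → Dec (Unclosed t L)
  unclosed? t L = Fin.any? λ i → Fin.any? λ j → i Fin.<? j ×-dec ¬? (closed? t i j L)

  ¬unclosed⇒shifted : ∀ {t L} → ¬ Unclosed t L → Shifted t ⟦ L ⟧
  ¬unclosed⇒shifted {t} {L} ¬unclosed i j i<j G = mk⇔ to (λ G∈L → inj₂ (G∈L , All.lookup closed G∈L))
    where
    closed : Closed t i j L
    closed = decidable-stable (closed? t i j L) λ ¬closed → ¬unclosed (i , j , i<j , ¬closed)
    to : shiftFam t i j ⟦ L ⟧ G → G ∈ L
    to (inj₁ (A , A∈L , refl)) = All.lookup closed A∈L
    to (inj₂ (G∈L , _))        = G∈L

  Improvable : List (MSet ns) → Set
  Improvable L = ∃[ t ] ∃[ i ] ∃[ j ] (i Fin.< j × ¬ Closed t i j L × ¬ TriviallyIntersecting ⟦ shiftList t i j L ⟧)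

  improvable? : ∀ L → Dec (Improvable L)
  improvable? L = Fin.any? λ t → Fin.any? λ i → Fin.any? λ j →
    i Fin.<? j ×-dec ¬? (closed? t i j L) ×-dec ¬? (triviallyIntersecting? (shiftList t i j L))

  ¬improvable⇒QShifted : ∀ {L} → NonTriviallyIntersecting ⟦ L ⟧ → ¬ Improvable L → ∃[ Q ] QShifted Q ⟦ L ⟧
  ¬improvable⇒QShifted {L} ntI ¬improvable = Q , ntI , shifted , trivialised
    where
    Q = comprehension (λ s → ¬? (unclosed? s L))

    shifted : ∀ s → s Subset.∈ Q → Shifted s ⟦ L ⟧
    shifted s s∈Q = ¬unclosed⇒shifted (∈-comprehension⁻ (λ s → ¬? (unclosed? s L)) s∈Q)

    trivialised : ∀ s → ¬ s Subset.∈ Q → ∃[ i ] ∃[ j ] (i Fin.< j × TriviallyIntersecting (shiftFam s i j ⟦ L ⟧))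
    trivialised s s∉Q with decidable-stable (unclosed? s L) (∉-comprehension⁻ (λ s → ¬? (unclosed? s L)) s∉Q)
    ... | i , j , i<j , ¬closed = i , j , i<j ,
      TriviallyIntersecting-mono (Equivalence.from (Shift.∈-shiftList⇔ {ns = ns} s i j (Fin.<⇒≢ i<j) L _))
        (decidable-stable (triviallyIntersecting? (shiftList s i j L)) λ ¬trivial →
          ¬improvable (s , i , j , i<j , ¬closed , ¬trivial))

module _ {p} {ns : Vec ℕ p} (ks : Vec ℕ p) where

  Good : List (MSet ns) → Set
  Good L = FamilyIn ks L × NonTriviallyIntersecting ⟦ L ⟧

  shiftList-good : ∀ {L t i j} → i Fin.< j → Good L → ¬ TriviallyIntersecting ⟦ shiftList t i j L ⟧
    → Good (shiftList t i j L)
  shiftList-good {L} {t} {i} {j} i<j ((L! , L⊆) , I , _) ¬trivial =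
    (shiftList-Unique L L! , shiftList-InProduct L {ks} L⊆) ,
    Intersecting-mono (Equivalence.to (∈-shiftList⇔ L _)) (shiftFam-intersecting I) , ¬trivial
    where open Shift {ns = ns} t i j (Fin.<⇒≢ i<j)

  largestGood : ∃ Good → ∃[ M ] (Good M × ∀ G → Good G → length G ≤ length M)
  largestGood (G , good) with Largest.largest (_≟ₘ_ {ns = ns}) (allMSets ns) ∈-allMSets P? P-resp (G , assocʳ′ good)
    where
    P : List (MSet ns) → Set
    P L = (∀ F → F ∈ L → InProduct ks F) × NonTriviallyIntersecting ⟦ L ⟧
    P? : Decidable P
    P? L = ∀∈? (inProduct? ks) L ×-dec nonTriviallyIntersecting? L
    P-resp : ∀ {L M} → L ⊆ M → M ⊆ L → P L → P M
    P-resp L⊆M M⊆L (L⊆∏ , ntI) = (λ F → L⊆∏ F ∘ M⊆L) , NonTriviallyIntersecting-resp M⊆L L⊆M ntI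
  ... | M , admissible , M-largest = M , assocˡ′ admissible , λ G → M-largest G ∘ assocʳ′

  stabilise : ∀ L → Acc _<_ (totalWeight L) → Good L
    → ∃[ L′ ] (Good L′ × length L′ ≡ length L × ∃[ Q ] QShifted Q ⟦ L′ ⟧)
  stabilise L (acc rec) good with improvable? L
  ... | no ¬improvable = L , good , refl , ¬improvable⇒QShifted (proj₂ good) ¬improvable
  ... | yes (t , i , j , i<j , ¬closed , ¬trivial)
    with stabilise (shiftList t i j L)
           (rec (Shift.totalWeight-shiftList-< {ns = ns} t i j (Fin.<⇒≢ i<j) L i<j ¬closed))
           (shiftList-good i<j good ¬trivial)
  ...   | L′ , good′ , |L′|≡ , Q-shifted = L′ , good′ , trans |L′|≡ (List.length-map _ L) , Q-shifted

lemma2p3 : (p : ℕ) → p ≥ 1 → (ns ks : Vec ℕ p)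
    → (∀ (s : Fin p) → lookup ns s ≥ 1)
    → (∀ (s : Fin p) → 1 ≤ lookup ks s × lookup ks s ≤ lookup ns s)
    → (∃[ 𝓖 ] (FamilyIn {ns = ns} ks 𝓖 × NonTriviallyIntersecting ⟦ 𝓖 ⟧))
    → ∃[ 𝓕 ] (FamilyIn {ns = ns} ks 𝓕 × NonTriviallyIntersecting ⟦ 𝓕 ⟧
        × (∀ 𝓖 → FamilyIn {ns = ns} ks 𝓖 → NonTriviallyIntersecting ⟦ 𝓖 ⟧ → length 𝓖 ≤ length 𝓕)
        × ∃[ Q ] QShifted Q ⟦ 𝓕 ⟧)
lemma2p3 _ _ ns ks _ _ good₀ =
  let M , good-M , M-largest = largestGood ks good₀
      F , (F-family , F-ntI) , |F|≡|M| , Q-shifted = stabilise ks M (<-wellFounded _) good-M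
  in F , F-family , F-ntI
     , (λ G G-family G-ntI → ℕ.≤-trans (M-largest G (G-family , G-ntI)) (ℕ.≤-reflexive (sym |F|≡|M|)))
     , Q-shifted
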